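{- Let $H=(H^\bullet,H^\times)$ be a hypergraph and $\mathcal{H}$ the set of its subhypergraphs. Then: 1. $\gamma_{1/2}$ and $\gamma_1$ are openings and $\phi_{1/2}$ and $\phi_1$ are closings on the power set of $H^\bullet$; $\Gamma_{1/2}$ and $\Gamma_1$ are openings and $\Phi_{1/2}$ and $\Phi_1$ are closings on the power set of $H^\times$. 2. $\mathcal{H}$ is closed under $[\gamma,\Gamma]_{1/2}$, $[\phi,\Phi]_{1/2}$, $[\gamma,\Gamma]_1$ and $[\phi,\Phi]_1$ (each maps subhypergraphs to subhypergraphs). 3. $[\gamma,\Gamma]_{1/2}$ and $[\gamma,\Gamma]_1$ are openings on $(\mathcal{H},\subseteq)$, and $[\phi,\Phi]_{1/2}$ and $[\phi,\Phi]_1$ are closings on $(\mathcal{H},\subseteq)$.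
   Context: A hypergraph is a pair $H=(H^\bullet,H^\times)$ where $H^\bullet$ is a set of vertices and $H^\times=(e_i)_{i\in I}$ is a family of hyperedges indexed by a finite set $I$, each with vertex set $v(e)\subseteq H^\bullet$. Subsets of $H^\times$ are subfamilies $X^\times=(e_j)_{j\in J}$, $J\subseteq I$. A subhypergraph is $X=(X^\bullet,X^\times)$ with $X^\bullet\subseteq H^\bullet$, $X^\times\subseteq H^\times$, $v(e)\subseteq X^\bullet$ for all $e\in X^\times$; inclusion is componentwise. Operators: $\delta^\bullet(X^\times)=\bigcup_{j\in J}v(e_j)$; $\epsilon^\bullet(X^\times)=\bigcap_{i\in I\setminus J}\overline{v(e_i)}$; $\epsilon^\times(X^\bullet)=\{e_i\mid v(e_i)\subseteq X^\bullet\}$; $\delta^\times(X^\bullet)=\{e_i\mid v(e_i)\cap X^\bullet\neq\emptyset\}$; $\delta=\delta^\bullet\circ\delta^\times$, $\epsilon=\epsilon^\bullet\circ\epsilon^\times$; $\Delta=\delta^\times\circ\delta^\bullet$, $\varepsilon=\epsilon^\times\circ\epsilon^\bullet$; $\gamma_1=\delta\circ\epsilon$, $\phi_1=\epsilon\circ\delta$, $\Gamma_1=\Delta\circ\varepsilon$, $\Phi_1=\varepsilon\circ\Delta$; $\gamma_{1/2}=\delta^\bullet\circ\epsilon^\times$, $\phi_{1/2}=\epsilon^\bullet\circ\delta^\times$, $\Gamma_{1/2}=\delta^\times\circ\epsilon^\bullet$, $\Phi_{1/2}=\epsilon^\times\circ\delta^\bullet$; for $k\in\{1,1/2\}$, $[\gamma,\Gamma]_k(X)=(\gamma_k(X^\bullet),\Gamma_k(X^\times))$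 and $[\phi,\Phi]_k(X)=(\phi_k(X^\bullet),\Phi_k(X^\times))$. An opening on a lattice is an increasing, idempotent, anti-extensive operator; a closing is an increasing, idempotent, extensive operator. -}

module Defs where

open import Level using (0ℓ)
open import Data.Nat using (ℕ)
open import Data.Fin using (Fin)
open import Data.Product using (Σ; ∃; _×_; _,_; proj₁; proj₂)
open import Relation.Nullary using (¬_)
open import Relation.Unary using (Pred; _∈_; _∉_; _⊆_; _≐_; ∁)

-- A hypergraph: a set of vertices V, hyperedges indexed by a finite set
-- I = Fin m, each hyperedge i having vertex set v i ⊆ V.
record Hypergraph : Set₁ where
  field
    V : Set
    m : ℕ
    v : Fin m → Pred V 0ℓ

module _ (H : Hypergraph) where
  open Hypergraph H

  -- subsets of H^• and subfamilies of H^× (given by their index sets J ⊆ I)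
  VSet : Set₁
  VSet = Pred V 0ℓ

  ESet : Set₁
  ESet = Pred (Fin m) 0ℓ

  δ• : ESet → VSet
  δ• J = λ x → ∃ λ j → j ∈ J × x ∈ v j

  ε• : ESet → VSet
  ε• J = λ x → ∀ i → i ∈ ∁ J → x ∉ v i

  ε× : VSet → ESet
  ε× X = λ i → v i ⊆ X

  δ× : VSet → ESet
  δ× X = λ i → ∃ λ x → x ∈ v i × x ∈ X

  δ ε : VSet → VSet
  δ X = δ• (δ× X)
  ε X = ε• (ε× X)

  Δ ϵ : ESet → ESet
  Δ J = δ× (δ• J)
  ϵ J = ε× (ε• J)

  γ₁ φ₁ γ½ φ½ : VSet → VSet
  γ₁ X = δ (ε X)
  φ₁ X = ε (δ X)
  γ½ X = δ• (ε× X)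
  φ½ X = ε• (δ× X)

  Γ₁ Φ₁ Γ½ Φ½ : ESet → ESet
  Γ₁ J = Δ (ϵ J)
  Φ₁ J = ϵ (Δ J)
  Γ½ J = δ× (ε• J)
  Φ½ J = ε× (δ• J)

  Pair : Set₁
  Pair = VSet × ESet

  IsSub : Pair → Set
  IsSub (X• , X×) = ∀ i → i ∈ X× → v i ⊆ X•

  _⊑_ : Pair → Pair → Set
  (X• , X×) ⊑ (Y• , Y×) = (X• ⊆ Y•) × (X× ⊆ Y×)

  _≋_ : Pair → Pair → Set
  (X• , X×) ≋ (Y• , Y×) = (X• ≐ Y•) × (X× ≐ Y×)

  [γ,Γ]₁ [φ,Φ]₁ [γ,Γ]½ [φ,Φ]½ : Pair → Pair
  [γ,Γ]₁ (X• , X×) = γ₁ X• , Γ₁ X×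
  [φ,Φ]₁ (X• , X×) = φ₁ X• , Φ₁ X×
  [γ,Γ]½ (X• , X×) = γ½ X• , Γ½ X×
  [φ,Φ]½ (X• , X×) = φ½ X• , Φ½ X×

record IsOpeningOn {A : Set₁} (D : A → Set) (_≤_ _≈_ : A → A → Set)
                   (f : A → A) : Set₁ where
  field
    increasing    : ∀ {X Y} → D X → D Y → X ≤ Y → f X ≤ f Y
    idempotent    : ∀ {X} → D X → f (f X) ≈ f X
    anti-extensive : ∀ {X} → D X → f X ≤ X

record IsClosingOn {A : Set₁} (D : A → Set) (_≤_ _≈_ : A → A → Set)
                   (f : A → A) : Set₁ where
  field
    increasing : ∀ {X Y} → D X → D Y → X ≤ Y → f X ≤ f Y
    idempotent : ∀ {X} → D X → f (f X) ≈ f X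
    extensive  : ∀ {X} → D X → X ≤ f X

All : {A : Set₁} → A → Set
All _ = Data.Unit.⊤
  where import Data.Unit

module _ {B : Set} where
  IsOpening IsClosing : (Pred B 0ℓ → Pred B 0ℓ) → Set₁
  IsOpening = IsOpeningOn All (λ X Y → X ⊆ Y) (λ X Y → X ≐ Y)
  IsClosing = IsClosingOn All (λ X Y → X ⊆ Y) (λ X Y → X ≐ Y)

module Submission where

open import Defs
open import Level using (0ℓ)
open import Data.Product using (_×_; _,_; proj₁; proj₂)
open import Data.Empty using (⊥-elim)
open import Relation.Nullary using (yes; no)
open import Relation.Unary using (Pred; _⊆_; _∈_)
open import Relation.Unary.Relation.Binary.Subset using (⊆-preorder)
import Relation.Binary.Reasoning.Preorder
open import Axiom.ExcludedMiddle using (ExcludedMiddle)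

-- The eight operators on H^• and H^× are all built from two
-- (monotone) Galois connections between the power sets of H^× and H^•:
--   δ• ⊣ ε×   (an edge family covers X iff every edge lies in X), and
--   δ× ⊣ ε•   (classically: the counit needs excluded middle).
-- For any Galois connection L ⊣ R, L ∘ R is an opening and R ∘ L a closing,
-- and Galois connections compose; this gives part 1, since
-- γ½ = δ• ε×, φ½ = ε• δ×, Γ½ = δ× ε•, Φ½ = ε× δ•, and δ ⊣ ε, Δ ⊣ ϵ.
-- A pair (X•, X×) is a subhypergraph exactly when δ• X× ⊆ X•; for any two
-- Galois connections in the shape above, this "compatibility" relation is
-- preserved by the four pair operators, using only the unit, counit and
-- monotonicity laws (part 2).  Finally, an operator acting componentwise by
-- an opening (closing) on each factor is an opening (closing) on pairs,
-- whatever subset of pairs it is restricted to (part 3).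

module ⊆-Reasoning {A : Set} =
  Relation.Binary.Reasoning.Preorder (⊆-preorder A 0ℓ)

record GaloisConnection {P Q : Set}
    (L : Pred P 0ℓ → Pred Q 0ℓ) (R : Pred Q 0ℓ → Pred P 0ℓ) : Set₁ where
  field
    monoL  : ∀ {X Y} → X ⊆ Y → L X ⊆ L Y
    monoR  : ∀ {X Y} → X ⊆ Y → R X ⊆ R Y
    unit   : ∀ X → X ⊆ R (L X)
    counit : ∀ Y → L (R Y) ⊆ Y

  transpose : ∀ {X Y} → L X ⊆ Y → X ⊆ R Y
  transpose {X} {Y} LX⊆Y = begin
    X         ≲⟨ unit X ⟩
    R (L X)   ≲⟨ monoR LX⊆Y ⟩
    R Y       ∎
    where open ⊆-Reasoning

  opening : IsOpening (λ Y → L (R Y))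
  opening = record
    { increasing     = λ _ _ Y⊆Y′ → monoL (monoR Y⊆Y′)
    ; idempotent     = λ {Y} _ → counit (L (R Y)) , monoL (unit (R Y))
    ; anti-extensive = λ {Y} _ → counit Y
    }

  closing : IsClosing (λ X → R (L X))
  closing = record
    { increasing = λ _ _ X⊆X′ → monoR (monoL X⊆X′)
    ; idempotent = λ {X} _ → monoR (counit (L X)) , unit (R (L X))
    ; extensive  = λ {X} _ → unit X
    }

open GaloisConnection

compose : ∀ {P Q S} {L₁ : Pred P 0ℓ → Pred Q 0ℓ} {R₁}
            {L₂ : Pred Q 0ℓ → Pred S 0ℓ} {R₂} →
          GaloisConnection L₁ R₁ → GaloisConnection L₂ R₂ →
          GaloisConnection (λ X → L₂ (L₁ X)) (λ Y → R₁ (R₂ Y))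
compose {L₁ = L₁} {R₁} {L₂} {R₂} g h = record
  { monoL  = λ s → monoL h (monoL g s)
  ; monoR  = λ s → monoR g (monoR h s)
  ; unit   = λ X → begin
      X                   ≲⟨ unit g X ⟩
      R₁ (L₁ X)           ≲⟨ monoR g (unit h (L₁ X)) ⟩
      R₁ (R₂ (L₂ (L₁ X))) ∎
  ; counit = λ Y → begin
      L₂ (L₁ (R₁ (R₂ Y))) ≲⟨ monoL h (counit g (R₂ Y)) ⟩
      L₂ (R₂ Y)           ≲⟨ counit h Y ⟩
      Y                   ∎
  }
  where open ⊆-Reasoning

module Compatibility {V E : Set}
    {L₁ : Pred E 0ℓ → Pred V 0ℓ} {R₁ : Pred V 0ℓ → Pred E 0ℓ}
    {L₂ : Pred V 0ℓ → Pred E 0ℓ} {R₂ : Pred E 0ℓ → Pred V 0ℓ}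
    (g₁ : GaloisConnection L₁ R₁) (g₂ : GaloisConnection L₂ R₂) where

  open ⊆-Reasoning

  Compatible : Pred V 0ℓ → Pred E 0ℓ → Set
  Compatible B A = L₁ A ⊆ B

  -- (B, A) ↦ (L₁ R₁ B, L₂ R₂ A): shrink A into R₁ B, then apply L₁
  compatible-½-opening : ∀ {B A} → Compatible B A →
                         Compatible (L₁ (R₁ B)) (L₂ (R₂ A))
  compatible-½-opening {B} {A} c = monoL g₁ (begin
    L₂ (R₂ A) ≲⟨ counit g₂ A ⟩
    A         ≲⟨ transpose g₁ c ⟩
    R₁ B      ∎)

  compatible-½-closing : ∀ {B A} → Compatible B A →
                         Compatible (R₂ (L₂ B)) (R₁ (L₁ A))
  compatible-½-closing {B} {A} c = begin
    L₁ (R₁ (L₁ A)) ≲⟨ counit g₁ (L₁ A) ⟩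
    L₁ A           ≲⟨ c ⟩
    B              ≲⟨ unit g₂ B ⟩
    R₂ (L₂ B)      ∎

  compatible-1-opening : ∀ {B A} → Compatible B A →
    Compatible (L₁ (L₂ (R₂ (R₁ B)))) (L₂ (L₁ (R₁ (R₂ A))))
  compatible-1-opening {B} {A} c = monoL g₁ (monoL g₂ (begin
    L₁ (R₁ (R₂ A)) ≲⟨ counit g₁ (R₂ A) ⟩
    R₂ A           ≲⟨ monoR g₂ (transpose g₁ c) ⟩
    R₂ (R₁ B)      ∎))

  compatible-1-closing : ∀ {B A} → Compatible B A →
    Compatible (R₂ (R₁ (L₁ (L₂ B)))) (R₁ (R₂ (L₂ (L₁ A))))
  compatible-1-closing {B} {A} c = begin
    L₁ (R₁ (R₂ (L₂ (L₁ A)))) ≲⟨ counit g₁ (R₂ (L₂ (L₁ A))) ⟩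
    R₂ (L₂ (L₁ A))           ≲⟨ monoR g₂ (monoL g₂ c) ⟩
    R₂ (L₂ B)                ≲⟨ monoR g₂ (unit g₁ (L₂ B)) ⟩
    R₂ (R₁ (L₁ (L₂ B)))      ∎

module Hypergraphs (em : ExcludedMiddle 0ℓ) (H : Hypergraph) where
  open Hypergraph H

  -- δ• J ⊆ X  iff  every edge of J lies in X  iff  J ⊆ ε× X
  δ•⊣ε× : GaloisConnection (δ• H) (ε× H)
  δ•⊣ε× = record
    { monoL  = λ J⊆J′ (j , j∈J , x∈vj) → j , J⊆J′ j∈J , x∈vj
    ; monoR  = λ X⊆X′ vi⊆X x∈vi → X⊆X′ (vi⊆X x∈vi)
    ; unit   = λ J {i} i∈J x∈vi → i , i∈J , x∈vi
    ; counit = λ X (j , vj⊆X , x∈vj) → vj⊆X x∈vj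
    }

  -- δ× X ⊆ J  iff  no edge outside J meets X  iff  X ⊆ ε• J
  δ×⊣ε• : GaloisConnection (δ× H) (ε• H)
  δ×⊣ε• = record
    { monoL  = λ X⊆X′ (x , x∈vi , x∈X) → x , x∈vi , X⊆X′ x∈X
    ; monoR  = λ J⊆J′ x∈εJ i i∉J′ → x∈εJ i (λ i∈J → i∉J′ (J⊆J′ i∈J))
    ; unit   = λ X {x} x∈X i i∉δX x∈vi → i∉δX (x , x∈vi , x∈X)
    ; counit = λ J {i} (x , x∈vi , x∈εJ) → meets-ε•⇒∈ J i x x∈vi x∈εJ
    }
    where
      meets-ε•⇒∈ : ∀ J i x → x ∈ v i → x ∈ ε• H J → i ∈ J
      meets-ε•⇒∈ J i x x∈vi x∈εJ with em {P = J i}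
      ... | yes i∈J = i∈J
      ... | no  i∉J = ⊥-elim (x∈εJ i i∉J x∈vi)

  δ⊣ε : GaloisConnection (δ H) (ε H)
  δ⊣ε = compose δ×⊣ε• δ•⊣ε×

  Δ⊣ϵ : GaloisConnection (Δ H) (ϵ H)
  Δ⊣ϵ = compose δ•⊣ε× δ×⊣ε•

  open Compatibility δ•⊣ε× δ×⊣ε•

  sub⇒compatible : ∀ {X• X×} → IsSub H (X• , X×) → Compatible X• X×
  sub⇒compatible sub (j , j∈X , x∈vj) = sub j j∈X x∈vj

  compatible⇒sub : ∀ {X• X×} → Compatible X• X× → IsSub H (X• , X×)
  compatible⇒sub c i i∈X x∈vi = c (i , i∈X , x∈vi)

  subhypergraphs-closed : ∀ X → IsSub H X →
    IsSub H ([γ,Γ]½ H X) × IsSub H ([φ,Φ]½ H X)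
      × IsSub H ([γ,Γ]₁ H X) × IsSub H ([φ,Φ]₁ H X)
  subhypergraphs-closed _ sub =
    compatible⇒sub (compatible-½-opening c) ,
    compatible⇒sub (compatible-½-closing c) ,
    compatible⇒sub (compatible-1-opening c) ,
    compatible⇒sub (compatible-1-closing c)
    where c = sub⇒compatible sub

module Pairs (H : Hypergraph) where

  pair-opening : ∀ {D f g} → IsOpening f → IsOpening g →
    IsOpeningOn D (_⊑_ H) (_≋_ H) (λ X → f (proj₁ X) , g (proj₂ X))
  pair-opening of og = record
    { increasing     = λ _ _ (s , t) → increasing of _ _ s , increasing og _ _ t
    ; idempotent     = λ _ → idempotent of _ , idempotent og _
    ; anti-extensive = λ _ → anti-extensive of _ , anti-extensive og _
    }
    where open IsOpeningOn

  pair-closing : ∀ {D f g} → IsClosing f → IsClosing g →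
    IsClosingOn D (_⊑_ H) (_≋_ H) (λ X → f (proj₁ X) , g (proj₂ X))
  pair-closing cf cg = record
    { increasing = λ _ _ (s , t) → increasing cf _ _ s , increasing cg _ _ t
    ; idempotent = λ _ → idempotent cf _ , idempotent cg _
    ; extensive  = λ _ → extensive cf _ , extensive cg _
    }
    where open IsClosingOn

mainTheorem10 : ExcludedMiddle 0ℓ → (H : Hypergraph) →
    (IsOpening (γ½ H) × IsOpening (γ₁ H) × IsClosing (φ½ H) × IsClosing (φ₁ H)
    × IsOpening (Γ½ H) × IsOpening (Γ₁ H) × IsClosing (Φ½ H) × IsClosing (Φ₁ H))
    × (∀ X → IsSub H X → IsSub H ([γ,Γ]½ H X) × IsSub H ([φ,Φ]½ H X)
    × IsSub H ([γ,Γ]₁ H X) × IsSub H ([φ,Φ]₁ H X))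
    × (IsOpeningOn (IsSub H) (_⊑_ H) (_≋_ H) ([γ,Γ]½ H)
    × IsOpeningOn (IsSub H) (_⊑_ H) (_≋_ H) ([γ,Γ]₁ H)
    × IsClosingOn (IsSub H) (_⊑_ H) (_≋_ H) ([φ,Φ]½ H)
    × IsClosingOn (IsSub H) (_⊑_ H) (_≋_ H) ([φ,Φ]₁ H))
mainTheorem10 em H =
  ( opening δ•⊣ε× , opening δ⊣ε , closing δ×⊣ε• , closing δ⊣ε
  , opening δ×⊣ε• , opening Δ⊣ϵ , closing δ•⊣ε× , closing Δ⊣ϵ ) ,
  subhypergraphs-closed ,
  ( pair-opening (opening δ•⊣ε×) (opening δ×⊣ε•)
  , pair-opening (opening δ⊣ε) (opening Δ⊣ϵ)
  , pair-closing (closing δ×⊣ε•) (closing δ•⊣ε×)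
  , pair-closing (closing δ⊣ε) (closing Δ⊣ϵ) )
  where open Hypergraphs em H
        open Pairs H
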